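{- Let $$D(x,y,z)=\sum_{T} x^{e(T)}\,y^{h(T)}\,z^{m(T)},$$ the sum ranging over all rooted ordered trees $T$ with at least one edge. Then, as formal power series, $$D(x,y,z)=y\,D\!\left(x,y,\frac{1}{1-xz}\right)-y\,D(x,y,1)+\frac{xyz}{1-xz}.$$
   Context: Rooted ordered (plane) trees have the children of each vertex ordered left to right. For such a tree $T$: $e(T)$ is its number of edges; the depth of a vertex is the number of edges on the path from the root to it; $h(T)$, the height, is the maximal depth of a vertex; $m(T)$ is the number of vertices at depth $h(T)$. -}

module Defs where

open import Data.Nat as ℕ using (ℕ; zero; suc; _⊔_; _∸_; _≤ᵇ_; _≡ᵇ_)
open import Data.Bool using (Bool; true; false; if_then_else_; _∧_)
open import Data.Integer as ℤ using (ℤ; 0ℤ; 1ℤ)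
open import Data.List using (List; []; _∷_; map; concatMap; upTo; foldr)
open import Relation.Binary.PropositionalEquality using (_≡_)

data Tree : Set where
  node : List Tree → Tree

mutual
  edges : Tree → ℕ
  edges (node ts) = edgesF ts

  -- edges of a forest hanging below a vertex (including the edges to the roots)
  edgesF : List Tree → ℕ
  edgesF [] = 0
  edgesF (t ∷ ts) = suc (edges t) ℕ.+ edgesF ts

mutual
  height : Tree → ℕ
  height (node ts) = heightF ts

  heightF : List Tree → ℕ
  heightF [] = 0
  heightF (t ∷ ts) = suc (height t) ⊔ heightF ts

mutual
  level : ℕ → Tree → ℕ
  level zero    _         = 1
  level (suc d) (node ts) = levelF d ts

  levelF : ℕ → List Tree → ℕ
  levelF d [] = 0
  levelF d (t ∷ ts) = level d t ℕ.+ levelF d ts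

mtop : Tree → ℕ
mtop t = level (height t) t

-- Enumeration of all plane trees with a given number of edges.
-- forestsF fuel n lists all forests (lists of trees) f with edgesF f ≡ n
-- (fuel ≥ n+1 suffices; the fuel only ensures structural termination).

forestsF : ℕ → ℕ → List (List Tree)
forestsF zero       _       = []
forestsF (suc fuel) zero    = [] ∷ []
forestsF (suc fuel) (suc n) =
  concatMap (λ i →
    concatMap (λ g → map (λ rest → node g ∷ rest) (forestsF fuel (n ∸ i)))
              (forestsF fuel i))
    (upTo (suc n))

forests : ℕ → List (List Tree)
forests n = forestsF (suc n) n

trees : ℕ → List Tree
trees n = map node (forests n)

-- Formal power series in x, y, z with integer coefficients,
-- given by their coefficient functions: s n h k = [x^n y^h z^k] s.

Series : Set
Series = ℕ → ℕ → ℕ → ℤ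

Σ< : ℕ → (ℕ → ℤ) → ℤ
Σ< zero    f = 0ℤ
Σ< (suc n) f = Σ< n f ℤ.+ f n

sumℤ : List ℤ → ℤ
sumℤ = foldr ℤ._+_ 0ℤ

infixl 6 _+S_ _-S_
infixl 7 _*S_

_+S_ : Series → Series → Series
(s +S t) n h k = s n h k ℤ.+ t n h k

_-S_ : Series → Series → Series
(s -S t) n h k = s n h k ℤ.- t n h k

_*S_ : Series → Series → Series
(s *S t) n h k =
  Σ< (suc n) λ a → Σ< (suc h) λ b → Σ< (suc k) λ c →
    s a b c ℤ.* t (n ∸ a) (h ∸ b) (k ∸ c)

oneS : Series
oneS zero zero zero = 1ℤ
oneS _    _    _    = 0ℤ

X Y Z : Series
X (suc zero) zero zero = 1ℤ
X _ _ _ = 0ℤ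
Y zero (suc zero) zero = 1ℤ
Y _ _ _ = 0ℤ
Z zero zero (suc zero) = 1ℤ
Z _ _ _ = 0ℤ

-- 1/(1 - x z) = Σ_j x^j z^j
geomXZ : Series
geomXZ n zero k = if n ≡ᵇ k then 1ℤ else 0ℤ
geomXZ n (suc h) k = 0ℤ

_^S_ : Series → ℕ → Series
s ^S zero  = oneS
s ^S suc m = s *S (s ^S m)

shiftXY : ℕ → ℕ → Series → Series
shiftXY a b s n h k = if (a ≤ᵇ n) ∧ (b ≤ᵇ h) then s (n ∸ a) (h ∸ b) k else 0ℤ

-- Dsub g = D(x, y, g) = Σ_{T, e(T) ≥ 1} x^{e(T)} y^{h(T)} g^{m(T)}.
-- For the coefficient of x^n only trees with e(T) ≤ n can contribute
-- (the shift by x^{e(T)} gives 0 otherwise), so the sum is over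
-- trees with 1 ≤ e(T) ≤ n.
Dsub : Series → Series
Dsub g n h k =
  Σ< n λ i → sumℤ (map (λ T → shiftXY (edges T) (height T) (g ^S mtop T) n h k)
                      (trees (suc i)))

D : Series
D = Dsub Z

_≈S_ : Series → Series → Set
s ≈S t = ∀ n h k → s n h k ≡ t n h k

-- Pruning the deepest level of a plane tree T of height d + 1 leaves a tree T′ of height d,
-- together with the numbers of children of the vertices of T′ at depth d: a weak composition
-- of m(T) into m(T′) parts, from which T is recovered by grafting.  For k ≥ 1, the trees with
-- e = n, h = d + 1, m = k therefore correspond to the pairs (T′, c) with e(T′) = n − k,
-- h(T′) = d and c a weak composition of k into m(T′) parts, and such compositions are counted by
-- [(xz)ᵏ] (1 − xz)^(−m(T′)).  This is y D(x, y, 1/(1 − xz)), up to two corrections: D omits the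
-- one-vertex tree T′, whose grafts are the stars, counted by xyz/(1 − xz); and the constant term
-- in z counts every T′ once, which is y D(x, y, 1).  The bijection is verified by double counting
-- over the duplicate-free enumeration trees n.

module Submission where

open import Defs
open import Data.Bool using (true; false; if_then_else_)
open import Data.Integer using (ℤ; 0ℤ; 1ℤ; _+_; _*_; _-_)
import Data.Integer.Properties as ℤ
open import Data.Integer.Solver using (module +-*-Solver)
open import Data.List using (List; []; _∷_; _++_; map; concatMap; upTo; length; replicate; take; drop)
open import Data.List.Properties
  using (map-∘; map-cong; upTo-∷ʳ; ∷-dec; ≡-dec; length-++; length-take; length-drop; length-replicate; take++drop≡id)
open import Data.List.Relation.Unary.All as All using (All; []; _∷_)
open import Data.List.Relation.Unary.All.Properties using (concat⁺; map⁺; applyUpTo⁺₁)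
open import Data.Nat as ℕ using (ℕ; zero; suc; _∸_; _<_; _≤_; _⊓_; _≤ᵇ_; z≤n; s≤s; z<s)
open import Data.Nat.ListAction using (sum)
open import Data.Nat.ListAction.Properties using (sum-++)
open import Data.Nat.Properties
open import Data.Product using (_×_; _,_)
open import Data.Sum using (inj₁; inj₂)
open import Function using (id; _∘_)
open import Relation.Binary.Definitions using (DecidableEquality; tri<; tri≈; tri>)
open import Relation.Binary.PropositionalEquality
open import Relation.Nullary using (Dec; yes; no; does; ¬_)
open import Relation.Nullary.Decidable using (dec-true; dec-false; map′; _×-dec_)
open import Algebra.Properties.CommutativeSemigroup ℤ.+-commutativeSemigroup using () renaming (interchange to +-interchange)
open import Algebra.Properties.CommutativeSemigroup ℤ.*-commutativeSemigroup using (x∙yz≈y∙xz)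
open import Algebra.Properties.CommutativeSemigroup +-commutativeSemigroup using () renaming (interchange to ℕ-+-interchange)

private variable
  A B P Q : Set

χ : Dec P → ℤ
χ p = if does p then 1ℤ else 0ℤ

χ-yes : (p : Dec P) → P → χ p ≡ 1ℤ
χ-yes p x = cong (λ b → if b then 1ℤ else 0ℤ) (dec-true p x)

χ-no : (p : Dec P) → ¬ P → χ p ≡ 0ℤ
χ-no p ¬x = cong (λ b → if b then 1ℤ else 0ℤ) (dec-false p ¬x)

χ-cong : (P → Q) → (Q → P) → (p : Dec P) (q : Dec Q) → χ p ≡ χ q
χ-cong P→Q Q→P (yes x) q = sym (χ-yes q (P→Q x))
χ-cong P→Q Q→P (no ¬x) q = sym (χ-no q (¬x ∘ Q→P))

χ-*-cong : ∀ {x y} (p : Dec P) → (P → x ≡ y) → χ p * x ≡ χ p * y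
χ-*-cong (yes p) x≡y = cong (1ℤ *_) (x≡y p)
χ-*-cong (no _)  _   = refl

χ-×-dec : (p : Dec P) (q : Dec Q) → χ (p ×-dec q) ≡ χ p * χ q
χ-×-dec (yes _) (yes _) = refl
χ-×-dec (yes _) (no _)  = refl
χ-×-dec (no _)  _       = refl

χ-≟-sym : ∀ m n → χ (m ≟ n) ≡ χ (n ≟ m)
χ-≟-sym m n = χ-cong sym sym (m ≟ n) (n ≟ m)

χ-∸ : ∀ n a b → χ (a <? suc n) * χ (n ∸ a ≟ b) ≡ χ (n ≟ a ℕ.+ b)
χ-∸ n a b with a ≤? n
... | yes a≤n rewrite χ-yes (a <? suc n) (s≤s a≤n) =
  trans (ℤ.*-identityˡ _) (χ-cong n∸a≡b⇒n≡a+b n≡a+b⇒n∸a≡b (n ∸ a ≟ b) (n ≟ a ℕ.+ b))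
  where
  n∸a≡b⇒n≡a+b : n ∸ a ≡ b → n ≡ a ℕ.+ b
  n∸a≡b⇒n≡a+b refl = sym (m+[n∸m]≡n a≤n)
  n≡a+b⇒n∸a≡b : n ≡ a ℕ.+ b → n ∸ a ≡ b
  n≡a+b⇒n∸a≡b refl = m+n∸m≡n a b
... | no a≰n rewrite χ-no (a <? suc n) (a≰n ∘ ≤-pred) =
  sym (χ-no (n ≟ a ℕ.+ b) (λ { refl → a≰n (m≤m+n a b) }))

χ-≟-∸ : ∀ n k ℓ → χ (k ≟ ℓ) * χ (n ∸ k ≟ n ∸ ℓ) ≡ χ (ℓ ≟ k)
χ-≟-∸ n k ℓ with k ≟ ℓ
... | yes refl = trans (cong₂ _*_ (χ-yes (k ≟ k) refl) (χ-yes (n ∸ k ≟ n ∸ k) refl)) (sym (χ-yes (k ≟ k) refl))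
... | no k≢ℓ   = trans (cong (_* χ (n ∸ k ≟ n ∸ ℓ)) (χ-no (k ≟ ℓ) k≢ℓ)) (sym (χ-no (ℓ ≟ k) (k≢ℓ ∘ sym)))

χ-<-∸-≟ : ∀ {i n} k → i ≤ n → χ (i <? suc k) * χ (n ∸ i ≟ k ∸ i) ≡ χ (n ≟ k)
χ-<-∸-≟ {i} {n} k i≤n with i ≤? k
... | yes i≤k rewrite χ-yes (i <? suc k) (s≤s i≤k) =
  trans (ℤ.*-identityˡ _) (χ-cong (∸-cancelʳ-≡ i≤n i≤k) (cong (_∸ i)) (n ∸ i ≟ k ∸ i) (n ≟ k))
... | no i≰k rewrite χ-no (i <? suc k) (i≰k ∘ ≤-pred) =
  sym (χ-no (n ≟ k) λ { refl → i≰k i≤n })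

χ-≤-∸ : ∀ b h → χ (b ≤? h) * χ (h ∸ b ≟ 0) ≡ χ (b ≟ h)
χ-≤-∸ b h with b ≤? h
... | yes b≤h rewrite χ-yes (b ≤? h) b≤h =
  trans (ℤ.*-identityˡ _) (χ-cong (λ e → ≤-antisym b≤h (m∸n≡0⇒m≤n e)) (λ { refl → n∸n≡0 b }) (h ∸ b ≟ 0) (b ≟ h))
... | no b≰h rewrite χ-no (b ≤? h) b≰h = sym (χ-no (b ≟ h) λ { refl → b≰h ≤-refl })

Σ<-cong : ∀ n {f g : ℕ → ℤ} → (∀ {i} → i < n → f i ≡ g i) → Σ< n f ≡ Σ< n g
Σ<-cong zero    f≡g = refl
Σ<-cong (suc n) f≡g = cong₂ _+_ (Σ<-cong n (f≡g ∘ m<n⇒m<1+n)) (f≡g (n<1+n n))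

Σ<-*ˡ : ∀ n c (f : ℕ → ℤ) → Σ< n (λ i → c * f i) ≡ c * Σ< n f
Σ<-*ˡ zero    c f = sym (ℤ.*-zeroʳ c)
Σ<-*ˡ (suc n) c f = trans (cong (_+ c * f n) (Σ<-*ˡ n c f)) (sym (ℤ.*-distribˡ-+ c _ (f n)))

Σ<-δ : ∀ n a (f : ℕ → ℤ) → Σ< n (λ i → χ (i ≟ a) * f i) ≡ χ (a <? n) * f a
Σ<-δ zero    a f = refl
Σ<-δ (suc n) a f with <-cmp a n
... | tri< a<n a≢n _
  rewrite Σ<-δ n a f | χ-yes (a <? n) a<n | χ-no (n ≟ a) (a≢n ∘ sym) | χ-yes (a <? suc n) (m<n⇒m<1+n a<n)
  = ℤ.+-identityʳ _
... | tri≈ a≮n refl _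
  rewrite Σ<-δ n a f | χ-no (a <? a) a≮n | χ-yes (a ≟ a) refl | χ-yes (a <? suc a) (n<1+n a)
  = ℤ.+-identityˡ _
... | tri> _ a≢n n<a
  rewrite Σ<-δ n a f | χ-no (a <? n) (<-asym n<a) | χ-no (n ≟ a) (a≢n ∘ sym) | χ-no (a <? suc n) (<⇒≱ n<a ∘ ≤-pred)
  = refl

Σ<-δ-convolution : ∀ n a b → Σ< (suc n) (λ i → χ (i ≟ a) * χ (n ∸ i ≟ b)) ≡ χ (n ≟ a ℕ.+ b)
Σ<-δ-convolution n a b = trans (Σ<-δ (suc n) a (λ i → χ (n ∸ i ≟ b))) (χ-∸ n a b)

Σ<-δ-from-top : ∀ n c (f : ℕ → ℤ) → Σ< n (λ i → χ (n ∸ suc i ≟ c) * f (suc i)) ≡ χ (c <? n) * f (n ∸ c)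
Σ<-δ-from-top zero    c f = refl
Σ<-δ-from-top (suc n) c f with c ≤? n
... | yes c≤n = begin
  Σ< (suc n) (λ i → χ (n ∸ i ≟ c) * f (suc i))
    ≡⟨ Σ<-cong (suc n) (λ {i} i<1+n → cong (_* f (suc i)) (χ-cong (i≡n∸c (≤-pred i<1+n)) n∸i≡c (n ∸ i ≟ c) (i ≟ n ∸ c))) ⟩
  Σ< (suc n) (λ i → χ (i ≟ n ∸ c) * f (suc i))
    ≡⟨ Σ<-δ (suc n) (n ∸ c) (f ∘ suc) ⟩
  χ (n ∸ c <? suc n) * f (suc (n ∸ c))
    ≡⟨ cong₂ _*_ (trans (χ-yes (n ∸ c <? suc n) (s≤s (m∸n≤m n c))) (sym (χ-yes (c <? suc n) (s≤s c≤n))))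
                 (cong f (sym (+-∸-assoc 1 c≤n))) ⟩
  χ (c <? suc n) * f (suc n ∸ c) ∎
  where
  open ≡-Reasoning
  i≡n∸c : ∀ {i} → i ≤ n → n ∸ i ≡ c → i ≡ n ∸ c
  i≡n∸c i≤n refl = sym (m∸[m∸n]≡n i≤n)
  n∸i≡c : ∀ {i} → i ≡ n ∸ c → n ∸ i ≡ c
  n∸i≡c refl = m∸[m∸n]≡n c≤n
... | no c≰n = begin
  Σ< (suc n) (λ i → χ (n ∸ i ≟ c) * f (suc i))
    ≡⟨ Σ<-cong (suc n) (λ {i} _ → cong (_* f (suc i)) (χ-no (n ∸ i ≟ c) λ { refl → c≰n (m∸n≤m n i) })) ⟩
  Σ< (suc n) (λ i → 0ℤ * f (suc i))
    ≡⟨ Σ<-*ˡ (suc n) 0ℤ (f ∘ suc) ⟩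
  0ℤ
    ≡⟨ cong (_* f (suc n ∸ c)) (χ-no (c <? suc n) (c≰n ∘ ≤-pred)) ⟨
  χ (c <? suc n) * f (suc n ∸ c) ∎
  where open ≡-Reasoning

∑ : List A → (A → ℤ) → ℤ
∑ xs f = sumℤ (map f xs)

infix 5 ∑
syntax ∑ xs (λ x → e) = ∑[ x ∈ xs ] e

∑-++ : ∀ xs ys (f : A → ℤ) → ∑ (xs ++ ys) f ≡ ∑ xs f + ∑ ys f
∑-++ []       ys f = sym (ℤ.+-identityˡ _)
∑-++ (x ∷ xs) ys f = trans (cong (f x +_) (∑-++ xs ys f)) (sym (ℤ.+-assoc (f x) _ _))

∑-map : ∀ (g : A → B) xs (f : B → ℤ) → ∑ (map g xs) f ≡ ∑ xs (f ∘ g)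
∑-map g xs f = cong sumℤ (sym (map-∘ xs))

∑-concatMap : ∀ (g : A → List B) xs (f : B → ℤ) → ∑ (concatMap g xs) f ≡ ∑[ x ∈ xs ] ∑ (g x) f
∑-concatMap g []       f = refl
∑-concatMap g (x ∷ xs) f = trans (∑-++ (g x) _ f) (cong (∑ (g x) f +_) (∑-concatMap g xs f))

∑-upTo : ∀ n (f : ℕ → ℤ) → ∑ (upTo n) f ≡ Σ< n f
∑-upTo zero    f = refl
∑-upTo (suc n) f = begin
  ∑ (upTo (suc n)) f               ≡⟨ cong (λ is → ∑ is f) (upTo-∷ʳ n) ⟨
  ∑ (upTo n ++ n ∷ []) f           ≡⟨ ∑-++ (upTo n) (n ∷ []) f ⟩
  ∑ (upTo n) f + (f n + 0ℤ)        ≡⟨ cong₂ _+_ (∑-upTo n f) (ℤ.+-identityʳ (f n)) ⟩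
  Σ< n f + f n                     ∎
  where open ≡-Reasoning

∑-cong : ∀ {f g : A → ℤ} xs → (∀ x → f x ≡ g x) → ∑ xs f ≡ ∑ xs g
∑-cong xs f≗g = cong sumℤ (map-cong f≗g xs)

∑-congᴬ : ∀ {P : A → Set} {f g : A → ℤ} {xs} → All P xs → (∀ {x} → P x → f x ≡ g x) → ∑ xs f ≡ ∑ xs g
∑-congᴬ []         f≡g = refl
∑-congᴬ (px ∷ pxs) f≡g = cong₂ _+_ (f≡g px) (∑-congᴬ pxs f≡g)

∑-zero : ∀ (xs : List A) → ∑ xs (λ _ → 0ℤ) ≡ 0ℤ
∑-zero []       = refl
∑-zero (x ∷ xs) = trans (ℤ.+-identityˡ _) (∑-zero xs)

∑-zeroᴬ : ∀ {P : A → Set} {f : A → ℤ} {xs} → All P xs → (∀ {x} → P x → f x ≡ 0ℤ) → ∑ xs f ≡ 0ℤ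
∑-zeroᴬ {xs = xs} pxs f≡0 = trans (∑-congᴬ pxs f≡0) (∑-zero xs)

∑-*ˡ : ∀ c xs (f : A → ℤ) → ∑[ x ∈ xs ] c * f x ≡ c * ∑ xs f
∑-*ˡ c []       f = sym (ℤ.*-zeroʳ c)
∑-*ˡ c (x ∷ xs) f = trans (cong (c * f x +_) (∑-*ˡ c xs f)) (sym (ℤ.*-distribˡ-+ c (f x) _))

∑-+ : ∀ xs (f g : A → ℤ) → ∑[ x ∈ xs ] (f x + g x) ≡ ∑ xs f + ∑ xs g
∑-+ []       f g = refl
∑-+ (x ∷ xs) f g = trans (cong (f x + g x +_) (∑-+ xs f g)) (+-interchange (f x) (g x) _ _)

∑-swap : ∀ xs ys (f : A → B → ℤ) → ∑[ x ∈ xs ] ∑[ y ∈ ys ] f x y ≡ ∑[ y ∈ ys ] ∑[ x ∈ xs ] f x y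
∑-swap []       ys f = sym (∑-zero ys)
∑-swap (x ∷ xs) ys f = trans (cong (∑ ys (f x) +_) (∑-swap xs ys f)) (sym (∑-+ ys (f x) _))

take-length-++ : ∀ (xs ys : List A) → take (length xs) (xs ++ ys) ≡ xs
take-length-++ []       ys = refl
take-length-++ (x ∷ xs) ys = cong (x ∷_) (take-length-++ xs ys)

drop-length-++ : ∀ (xs ys : List A) → drop (length xs) (xs ++ ys) ≡ ys
drop-length-++ []       ys = refl
drop-length-++ (x ∷ xs) ys = drop-length-++ xs ys

length-take-+ : ∀ m (xs : List A) {n} → length xs ≡ m ℕ.+ n → length (take m xs) ≡ m
length-take-+ m xs {n} l = trans (length-take m xs) (trans (cong (m ⊓_) l) (m≤n⇒m⊓n≡m (m≤m+n m n)))

length-drop-+ : ∀ m (xs : List A) {n} → length xs ≡ m ℕ.+ n → length (drop m xs) ≡ n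
length-drop-+ m xs {n} l = trans (length-drop m xs) (trans (cong (_∸ m) l) (m+n∸m≡n m n))

module _ (_≟ᴬ_ : DecidableEquality A) where

  count : A → List A → ℤ
  count x xs = ∑[ y ∈ xs ] χ (y ≟ᴬ x)

  ∑-χ-≟ : ∀ x xs (f : A → ℤ) → ∑[ y ∈ xs ] χ (y ≟ᴬ x) * f y ≡ f x * count x xs
  ∑-χ-≟ x xs f = trans (∑-cong xs χ-≟-* ) (∑-*ˡ (f x) xs _)
    where
    χ-≟-* : ∀ y → χ (y ≟ᴬ x) * f y ≡ f x * χ (y ≟ᴬ x)
    χ-≟-* y with y ≟ᴬ x
    ... | yes refl = ℤ.*-comm 1ℤ (f y)
    ... | no _     = sym (ℤ.*-zeroʳ (f x))


-- Enumeration of plane trees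

leaf : Tree
leaf = node []

node-injective : ∀ {ts us} → node ts ≡ node us → ts ≡ us
node-injective refl = refl

infix 4 _≟ᵀ_ _≟ᶠ_

mutual
  _≟ᵀ_ : DecidableEquality Tree
  node ts ≟ᵀ node us = map′ (cong node) node-injective (ts ≟ᶠ us)

  _≟ᶠ_ : DecidableEquality (List Tree)
  []       ≟ᶠ []       = yes refl
  []       ≟ᶠ (_ ∷ _)  = no λ ()
  (_ ∷ _)  ≟ᶠ []       = no λ ()
  (t ∷ ts) ≟ᶠ (u ∷ us) = ∷-dec (t ≟ᵀ u) (ts ≟ᶠ us)

edgesF-forestsF : ∀ fuel n → All (λ f → edgesF f ≡ n) (forestsF fuel n)
edgesF-forestsF zero       n       = []
edgesF-forestsF (suc fuel) zero    = refl ∷ []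
edgesF-forestsF (suc fuel) (suc n) =
  concat⁺ (map⁺ (applyUpTo⁺₁ id (suc n) λ i<1+n →
    concat⁺ (map⁺ (All.map (conses-edgesF (≤-pred i<1+n)) (edgesF-forestsF fuel _)))))
  where
  conses-edgesF : ∀ {i g} → i ≤ n → edgesF g ≡ i →
                  All (λ f → edgesF f ≡ suc n) (map (node g ∷_) (forestsF fuel (n ∸ i)))
  conses-edgesF {i} {g} i≤n refl =
    map⁺ (All.map (λ er → cong suc (trans (cong (edgesF g ℕ.+_) er) (m+[n∸m]≡n i≤n)))
                  (edgesF-forestsF fuel (n ∸ i)))

count-forestsF : ∀ {fuel n} → n < fuel → ∀ f → count _≟ᶠ_ f (forestsF fuel n) ≡ χ (n ≟ edgesF f)
count-forestsF {suc fuel} {zero}  _ []      = refl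
count-forestsF {suc fuel} {zero}  _ (_ ∷ _) = refl
count-forestsF {suc fuel} {suc n} _ []      =
  ∑-zeroᴬ (edgesF-forestsF (suc fuel) (suc n)) (λ {f} e → χ-no (f ≟ᶠ []) (λ { refl → 0≢1+n e }))
count-forestsF {suc fuel} {suc n} (s≤s n<fuel) (node g₀ ∷ r₀) = begin
  count _≟ᶠ_ (node g₀ ∷ r₀) (forestsF (suc fuel) (suc n))
    ≡⟨ ∑-concatMap conses (upTo (suc n)) _ ⟩
  ∑[ i ∈ upTo (suc n) ] count _≟ᶠ_ (node g₀ ∷ r₀) (conses i)
    ≡⟨ ∑-upTo (suc n) _ ⟩
  Σ< (suc n) (λ i → count _≟ᶠ_ (node g₀ ∷ r₀) (conses i))
    ≡⟨ Σ<-cong (suc n) (count-conses ∘ ≤-pred) ⟩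
  Σ< (suc n) (λ i → χ (i ≟ edgesF g₀) * χ (n ∸ i ≟ edgesF r₀))
    ≡⟨ Σ<-δ-convolution n (edgesF g₀) (edgesF r₀) ⟩
  χ (n ≟ edgesF g₀ ℕ.+ edgesF r₀) ∎
  where
  open ≡-Reasoning
  conses : ℕ → List (List Tree)
  conses i = concatMap (λ g → map (node g ∷_) (forestsF fuel (n ∸ i))) (forestsF fuel i)

  count-conses : ∀ {i} → i ≤ n → count _≟ᶠ_ (node g₀ ∷ r₀) (conses i) ≡ χ (i ≟ edgesF g₀) * χ (n ∸ i ≟ edgesF r₀)
  count-conses {i} i≤n = begin
    count _≟ᶠ_ (node g₀ ∷ r₀) (conses i)
      ≡⟨ ∑-concatMap (λ g → map (node g ∷_) (forestsF fuel (n ∸ i))) (forestsF fuel i) _ ⟩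
    ∑[ g ∈ forestsF fuel i ] ∑ (map (node g ∷_) (forestsF fuel (n ∸ i))) (λ f → χ (f ≟ᶠ node g₀ ∷ r₀))
      ≡⟨ ∑-cong (forestsF fuel i) (λ g → trans (∑-map (node g ∷_) (forestsF fuel (n ∸ i)) _)
                             (∑-cong (forestsF fuel (n ∸ i)) (λ r → χ-×-dec (node g ≟ᵀ node g₀) (r ≟ᶠ r₀)))) ⟩
    ∑[ g ∈ forestsF fuel i ] ∑[ r ∈ forestsF fuel (n ∸ i) ] χ (g ≟ᶠ g₀) * χ (r ≟ᶠ r₀)
      ≡⟨ ∑-cong (forestsF fuel i) (λ g → ∑-*ˡ (χ (g ≟ᶠ g₀)) (forestsF fuel (n ∸ i)) (λ r → χ (r ≟ᶠ r₀))) ⟩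
    ∑[ g ∈ forestsF fuel i ] χ (g ≟ᶠ g₀) * count _≟ᶠ_ r₀ (forestsF fuel (n ∸ i))
      ≡⟨ ∑-χ-≟ _≟ᶠ_ g₀ (forestsF fuel i) _ ⟩
    count _≟ᶠ_ r₀ (forestsF fuel (n ∸ i)) * count _≟ᶠ_ g₀ (forestsF fuel i)
      ≡⟨ cong₂ _*_ (count-forestsF (≤-<-trans (m∸n≤m n i) n<fuel) r₀) (count-forestsF (≤-<-trans i≤n n<fuel) g₀) ⟩
    χ (n ∸ i ≟ edgesF r₀) * χ (i ≟ edgesF g₀)
      ≡⟨ ℤ.*-comm (χ (n ∸ i ≟ edgesF r₀)) (χ (i ≟ edgesF g₀)) ⟩
    χ (i ≟ edgesF g₀) * χ (n ∸ i ≟ edgesF r₀) ∎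

count-trees : ∀ n T → count _≟ᵀ_ T (trees n) ≡ χ (n ≟ edges T)
count-trees n (node f) = trans (∑-map node (forests n) _) (count-forestsF {n = n} ≤-refl f)

edges-trees : ∀ n → All (λ T → edges T ≡ n) (trees n)
edges-trees n = map⁺ (edgesF-forestsF (suc n) n)

-- Pruning and grafting the deepest level

height-head : ∀ t ts {d} → heightF (t ∷ ts) ≤ suc d → height t ≤ d
height-head t ts h = ≤-pred (m⊔n≤o⇒m≤o (suc (height t)) (heightF ts) h)

height-tail : ∀ t ts {d} → heightF (t ∷ ts) ≤ d → heightF ts ≤ d
height-tail t ts = m⊔n≤o⇒n≤o (suc (height t)) (heightF ts)

height≤0⇒leaf : ∀ T → height T ≤ 0 → T ≡ leaf
height≤0⇒leaf (node [])       _ = refl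
height≤0⇒leaf (node (t ∷ ts)) h with () ← m⊔n≤o⇒m≤o (suc (height t)) (heightF ts) h

edgesF-leaves : ∀ m → edgesF (replicate m leaf) ≡ m
edgesF-leaves zero    = refl
edgesF-leaves (suc m) = cong suc (edgesF-leaves m)

heightF-leaves : ∀ m → heightF (replicate m leaf) ≤ 1
heightF-leaves zero    = z≤n
heightF-leaves (suc m) = ⊔-lub ≤-refl (heightF-leaves m)

leaves : ∀ ts → heightF ts ≤ 1 → replicate (length ts) leaf ≡ ts
leaves []       _ = refl
leaves (t ∷ ts) h = cong₂ _∷_ (sym (height≤0⇒leaf t (height-head t ts h))) (leaves ts (height-tail t ts h))

levelF-zero : ∀ ts → levelF 0 ts ≡ length ts
levelF-zero []       = refl
levelF-zero (t ∷ ts) = cong suc (levelF-zero ts)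

mutual
  level-above-height : ∀ d T → height T < d → level d T ≡ 0
  level-above-height (suc d) (node ts) h = levelF-above-heightF d ts h

  levelF-above-heightF : ∀ d ts → heightF ts < suc d → levelF d ts ≡ 0
  levelF-above-heightF d []       _ = refl
  levelF-above-heightF d (t ∷ ts) h =
    cong₂ ℕ._+_ (level-above-height d t (m⊔n≤o⇒m≤o (suc (height t)) (heightF ts) (≤-pred h)))
                (levelF-above-heightF d ts (s≤s (m⊔n≤o⇒n≤o (suc (height t)) (heightF ts) (≤-pred h))))

mutual
  level-height-positive : ∀ d T → height T ≡ d → 0 < level d T
  level-height-positive zero    _         _ = z<s
  level-height-positive (suc d) (node ts) h = levelF-heightF-positive d ts h

  levelF-heightF-positive : ∀ d ts → heightF ts ≡ suc d → 0 < levelF d ts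
  levelF-heightF-positive d (t ∷ ts) h with ≤-total (suc (height t)) (heightF ts)
  ... | inj₁ t≤ts = ≤-trans (levelF-heightF-positive d ts (trans (sym (m≤n⇒m⊔n≡n t≤ts)) h)) (m≤n+m _ _)
  ... | inj₂ ts≤t = ≤-trans (level-height-positive d t (suc-injective (trans (sym (m≥n⇒m⊔n≡m ts≤t)) h))) (m≤m+n _ _)

mutual
  level≤edges : ∀ d T → level (suc d) T ≤ edges T
  level≤edges d (node ts) = levelF≤edgesF d ts

  levelF≤edgesF : ∀ d ts → levelF d ts ≤ edgesF ts
  levelF≤edgesF d       []       = z≤n
  levelF≤edgesF zero    (t ∷ ts) = s≤s (≤-trans (levelF≤edgesF zero ts) (m≤n+m (edgesF ts) (edges t)))
  levelF≤edgesF (suc d) (t ∷ ts) = +-mono-≤ (≤-trans (level≤edges d t) (n≤1+n _)) (levelF≤edgesF (suc d) ts)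

mutual
  prune : ℕ → Tree → Tree
  prune zero    _         = leaf
  prune (suc d) (node ts) = node (pruneF d ts)

  pruneF : ℕ → List Tree → List Tree
  pruneF d []       = []
  pruneF d (t ∷ ts) = prune d t ∷ pruneF d ts

mutual
  childCounts : ℕ → Tree → List ℕ
  childCounts zero    (node ts) = length ts ∷ []
  childCounts (suc d) (node ts) = childCountsF d ts

  childCountsF : ℕ → List Tree → List ℕ
  childCountsF d []       = []
  childCountsF d (t ∷ ts) = childCounts d t ++ childCountsF d ts

-- graft d T cs gives the i-th vertex of depth d of T (from the left) cs_i new leaf children;
-- at depth 0, where cs is a singleton, the root receives sum cs leaves.
mutual
  graft : ℕ → Tree → List ℕ → Tree
  graft zero    _         cs = node (replicate (sum cs) leaf)
  graft (suc d) (node ts) cs = node (graftF d ts cs)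

  graftF : ℕ → List Tree → List ℕ → List Tree
  graftF d []       cs = []
  graftF d (t ∷ ts) cs = graft d t (take (level d t) cs) ∷ graftF d ts (drop (level d t) cs)

mutual
  height-prune : ∀ d T → height (prune d T) ≤ d
  height-prune zero    _         = z≤n
  height-prune (suc d) (node ts) = heightF-pruneF d ts

  heightF-pruneF : ∀ d ts → heightF (pruneF d ts) ≤ suc d
  heightF-pruneF d []       = z≤n
  heightF-pruneF d (t ∷ ts) = ⊔-lub (s≤s (height-prune d t)) (heightF-pruneF d ts)

mutual
  length-childCounts : ∀ d T → length (childCounts d T) ≡ level d (prune d T)
  length-childCounts zero    (node ts) = refl
  length-childCounts (suc d) (node ts) = length-childCountsF d ts

  length-childCountsF : ∀ d ts → length (childCountsF d ts) ≡ levelF d (pruneF d ts)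
  length-childCountsF d []       = refl
  length-childCountsF d (t ∷ ts) =
    trans (length-++ (childCounts d t)) (cong₂ ℕ._+_ (length-childCounts d t) (length-childCountsF d ts))

mutual
  sum-childCounts : ∀ d T → sum (childCounts d T) ≡ level (suc d) T
  sum-childCounts zero    (node ts) = trans (+-identityʳ (length ts)) (sym (levelF-zero ts))
  sum-childCounts (suc d) (node ts) = sum-childCountsF d ts

  sum-childCountsF : ∀ d ts → sum (childCountsF d ts) ≡ levelF (suc d) ts
  sum-childCountsF d []       = refl
  sum-childCountsF d (t ∷ ts) =
    trans (sum-++ (childCounts d t) _) (cong₂ ℕ._+_ (sum-childCounts d t) (sum-childCountsF d ts))

mutual
  height-graft : ∀ d T cs → height T ≤ d → height (graft d T cs) ≤ suc d
  height-graft zero    _         cs _ = heightF-leaves (sum cs)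
  height-graft (suc d) (node ts) cs h = heightF-graftF d ts cs h

  heightF-graftF : ∀ d ts cs → heightF ts ≤ suc d → heightF (graftF d ts cs) ≤ suc (suc d)
  heightF-graftF d []       cs _ = z≤n
  heightF-graftF d (t ∷ ts) cs h =
    ⊔-lub (s≤s (height-graft d t _ (height-head t ts h))) (heightF-graftF d ts _ (height-tail t ts h))

mutual
  prune-graft : ∀ d T cs → height T ≤ d → prune d (graft d T cs) ≡ T
  prune-graft zero    T         cs h = sym (height≤0⇒leaf T h)
  prune-graft (suc d) (node ts) cs h = cong node (pruneF-graftF d ts cs h)

  pruneF-graftF : ∀ d ts cs → heightF ts ≤ suc d → pruneF d (graftF d ts cs) ≡ ts
  pruneF-graftF d []       cs _ = refl
  pruneF-graftF d (t ∷ ts) cs h =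
    cong₂ _∷_ (prune-graft d t _ (height-head t ts h)) (pruneF-graftF d ts _ (height-tail t ts h))

mutual
  childCounts-graft : ∀ d T cs → length cs ≡ level d T → childCounts d (graft d T cs) ≡ cs
  childCounts-graft zero    T         (c ∷ [])     _ = cong (_∷ []) (trans (length-replicate (c ℕ.+ 0)) (+-identityʳ c))
  childCounts-graft (suc d) (node ts) cs           l = childCountsF-graftF d ts cs l

  childCountsF-graftF : ∀ d ts cs → length cs ≡ levelF d ts → childCountsF d (graftF d ts cs) ≡ cs
  childCountsF-graftF d []       [] _ = refl
  childCountsF-graftF d (t ∷ ts) cs l = begin
    childCounts d (graft d t (take ℓ cs)) ++ childCountsF d (graftF d ts (drop ℓ cs))
      ≡⟨ cong₂ _++_ (childCounts-graft d t _ (length-take-+ ℓ cs l))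
                    (childCountsF-graftF d ts _ (length-drop-+ ℓ cs l)) ⟩
    take ℓ cs ++ drop ℓ cs
      ≡⟨ take++drop≡id ℓ cs ⟩
    cs ∎
    where
    open ≡-Reasoning
    ℓ = level d t

mutual
  graft-prune : ∀ d T → height T ≤ suc d → graft d (prune d T) (childCounts d T) ≡ T
  graft-prune zero    (node ts) h = cong node (trans (cong (λ m → replicate m leaf) (+-identityʳ (length ts))) (leaves ts h))
  graft-prune (suc d) (node ts) h = cong node (graftF-pruneF d ts h)

  graftF-pruneF : ∀ d ts → heightF ts ≤ suc (suc d) → graftF d (pruneF d ts) (childCountsF d ts) ≡ ts
  graftF-pruneF d []       _ = refl
  graftF-pruneF d (t ∷ ts) h
    rewrite sym (length-childCounts d t)
          | take-length-++ (childCounts d t) (childCountsF d ts)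
          | drop-length-++ (childCounts d t) (childCountsF d ts)
    = cong₂ _∷_ (graft-prune d t (height-head t ts h)) (graftF-pruneF d ts (height-tail t ts h))

mutual
  edges-graft : ∀ d T cs → height T ≤ d → length cs ≡ level d T → edges (graft d T cs) ≡ edges T ℕ.+ sum cs
  edges-graft zero    T         cs h _ rewrite height≤0⇒leaf T h = edgesF-leaves (sum cs)
  edges-graft (suc d) (node ts) cs h l = edgesF-graftF d ts cs h l

  edgesF-graftF : ∀ d ts cs → heightF ts ≤ suc d → length cs ≡ levelF d ts →
                  edgesF (graftF d ts cs) ≡ edgesF ts ℕ.+ sum cs
  edgesF-graftF d []       [] _ _ = refl
  edgesF-graftF d (t ∷ ts) cs h l = cong suc (begin
    edges (graft d t (take ℓ cs)) ℕ.+ edgesF (graftF d ts (drop ℓ cs))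
      ≡⟨ cong₂ ℕ._+_ (edges-graft d t _ (height-head t ts h) (length-take-+ ℓ cs l))
                     (edgesF-graftF d ts _ (height-tail t ts h) (length-drop-+ ℓ cs l)) ⟩
    (edges t ℕ.+ sum (take ℓ cs)) ℕ.+ (edgesF ts ℕ.+ sum (drop ℓ cs))
      ≡⟨ ℕ-+-interchange (edges t) _ (edgesF ts) _ ⟩
    (edges t ℕ.+ edgesF ts) ℕ.+ (sum (take ℓ cs) ℕ.+ sum (drop ℓ cs))
      ≡⟨ cong (edges t ℕ.+ edgesF ts ℕ.+_) (trans (sym (sum-++ (take ℓ cs) (drop ℓ cs))) (cong sum (take++drop≡id ℓ cs))) ⟩
    edges t ℕ.+ edgesF ts ℕ.+ sum cs ∎)
    where
    open ≡-Reasoning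
    ℓ = level d t

edges-prune : ∀ d T → height T ≤ suc d → edges (prune d T) ℕ.+ level (suc d) T ≡ edges T
edges-prune d T h = begin
  edges (prune d T) ℕ.+ level (suc d) T
    ≡⟨ cong (edges (prune d T) ℕ.+_) (sum-childCounts d T) ⟨
  edges (prune d T) ℕ.+ sum (childCounts d T)
    ≡⟨ edges-graft d (prune d T) (childCounts d T) (height-prune d T) (length-childCounts d T) ⟨
  edges (graft d (prune d T) (childCounts d T))
    ≡⟨ cong edges (graft-prune d T h) ⟩
  edges T ∎
  where open ≡-Reasoning

-- Weak compositions

_≟ˡ_ : DecidableEquality (List ℕ)
_≟ˡ_ = ≡-dec _≟_

infix 4 _≟ˡ_

compositions : ℕ → ℕ → List (List ℕ)
compositions zero    zero    = [] ∷ []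
compositions zero    (suc k) = []
compositions (suc m) k       = concatMap (λ i → map (i ∷_) (compositions m (k ∸ i))) (upTo (suc k))

#compositions : ℕ → ℕ → ℤ
#compositions m k = ∑ (compositions m k) (λ _ → 1ℤ)

compositions-shape : ∀ m k → All (λ cs → length cs ≡ m × sum cs ≡ k) (compositions m k)
compositions-shape zero    zero    = (refl , refl) ∷ []
compositions-shape zero    (suc k) = []
compositions-shape (suc m) k       =
  concat⁺ (map⁺ (applyUpTo⁺₁ id (suc k) (conses-shape ∘ ≤-pred)))
  where
  conses-shape : ∀ {i} → i ≤ k → All (λ cs → length cs ≡ suc m × sum cs ≡ k) (map (i ∷_) (compositions m (k ∸ i)))
  conses-shape {i} i≤k =
    map⁺ (All.map (λ (l , s) → cong suc l , trans (cong (i ℕ.+_) s) (m+[n∸m]≡n i≤k)) (compositions-shape m (k ∸ i)))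

count-compositions : ∀ m k cs → count _≟ˡ_ cs (compositions m k) ≡ χ (m ≟ length cs) * χ (k ≟ sum cs)
count-compositions zero    zero    []       = refl
count-compositions zero    zero    (_ ∷ _)  = refl
count-compositions zero    (suc k) []       = refl
count-compositions zero    (suc k) (_ ∷ _)  = refl
count-compositions (suc m) k       []       =
  ∑-zeroᴬ (compositions-shape (suc m) k) (λ {cs} (l , _) → χ-no (cs ≟ˡ []) (λ { refl → 0≢1+n l }))
count-compositions (suc m) k       (c ∷ cs) = begin
  count _≟ˡ_ (c ∷ cs) (compositions (suc m) k)
    ≡⟨ ∑-concatMap conses (upTo (suc k)) _ ⟩
  ∑[ i ∈ upTo (suc k) ] count _≟ˡ_ (c ∷ cs) (conses i)
    ≡⟨ ∑-upTo (suc k) _ ⟩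
  Σ< (suc k) (λ i → count _≟ˡ_ (c ∷ cs) (conses i))
    ≡⟨ Σ<-cong (suc k) (λ {i} _ → count-conses i) ⟩
  Σ< (suc k) (λ i → χ (m ≟ length cs) * (χ (i ≟ c) * χ (k ∸ i ≟ sum cs)))
    ≡⟨ Σ<-*ˡ (suc k) (χ (m ≟ length cs)) _ ⟩
  χ (m ≟ length cs) * Σ< (suc k) (λ i → χ (i ≟ c) * χ (k ∸ i ≟ sum cs))
    ≡⟨ cong (χ (m ≟ length cs) *_) (Σ<-δ-convolution k c (sum cs)) ⟩
  χ (m ≟ length cs) * χ (k ≟ c ℕ.+ sum cs) ∎
  where
  open ≡-Reasoning
  conses : ℕ → List (List ℕ)
  conses i = map (i ∷_) (compositions m (k ∸ i))

  count-conses : ∀ i → count _≟ˡ_ (c ∷ cs) (conses i) ≡ χ (m ≟ length cs) * (χ (i ≟ c) * χ (k ∸ i ≟ sum cs))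
  count-conses i = begin
    count _≟ˡ_ (c ∷ cs) (conses i)
      ≡⟨ ∑-map (i ∷_) (compositions m (k ∸ i)) _ ⟩
    ∑[ y ∈ compositions m (k ∸ i) ] χ (i ∷ y ≟ˡ c ∷ cs)
      ≡⟨ ∑-cong (compositions m (k ∸ i)) (λ y → χ-×-dec (i ≟ c) (y ≟ˡ cs)) ⟩
    ∑[ y ∈ compositions m (k ∸ i) ] χ (i ≟ c) * χ (y ≟ˡ cs)
      ≡⟨ ∑-*ˡ (χ (i ≟ c)) (compositions m (k ∸ i)) _ ⟩
    χ (i ≟ c) * count _≟ˡ_ cs (compositions m (k ∸ i))
      ≡⟨ cong (χ (i ≟ c) *_) (count-compositions m (k ∸ i) cs) ⟩
    χ (i ≟ c) * (χ (m ≟ length cs) * χ (k ∸ i ≟ sum cs))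
      ≡⟨ x∙yz≈y∙xz (χ (i ≟ c)) (χ (m ≟ length cs)) (χ (k ∸ i ≟ sum cs)) ⟩
    χ (m ≟ length cs) * (χ (i ≟ c) * χ (k ∸ i ≟ sum cs)) ∎

#compositions-suc : ∀ m k → #compositions (suc m) k ≡ Σ< (suc k) (λ i → #compositions m (k ∸ i))
#compositions-suc m k = begin
  #compositions (suc m) k
    ≡⟨ ∑-concatMap (λ i → map (i ∷_) (compositions m (k ∸ i))) (upTo (suc k)) _ ⟩
  ∑[ i ∈ upTo (suc k) ] ∑ (map (i ∷_) (compositions m (k ∸ i))) (λ _ → 1ℤ)
    ≡⟨ ∑-cong (upTo (suc k)) (λ i → ∑-map (i ∷_) (compositions m (k ∸ i)) _) ⟩
  ∑[ i ∈ upTo (suc k) ] #compositions m (k ∸ i)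
    ≡⟨ ∑-upTo (suc k) _ ⟩
  Σ< (suc k) (λ i → #compositions m (k ∸ i)) ∎
  where open ≡-Reasoning

#compositions-zero-parts : ∀ k → #compositions 0 k ≡ χ (k ≟ 0)
#compositions-zero-parts zero    = refl
#compositions-zero-parts (suc k) = refl

#compositions-of-zero : ∀ m → #compositions m 0 ≡ 1ℤ
#compositions-of-zero zero    = refl
#compositions-of-zero (suc m) = trans (#compositions-suc m 0) (trans (ℤ.+-identityˡ _) (#compositions-of-zero m))

#compositions-one-part : ∀ k → #compositions 1 k ≡ 1ℤ
#compositions-one-part k = begin
  #compositions 1 k
    ≡⟨ #compositions-suc 0 k ⟩
  Σ< (suc k) (λ i → #compositions 0 (k ∸ i))
    ≡⟨ Σ<-cong (suc k) (λ {i} i<1+k → trans (#compositions-zero-parts (k ∸ i)) (only-k (≤-pred i<1+k))) ⟩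
  Σ< (suc k) (λ i → χ (i ≟ k) * 1ℤ)
    ≡⟨ Σ<-δ (suc k) k (λ _ → 1ℤ) ⟩
  χ (k <? suc k) * 1ℤ
    ≡⟨ cong (_* 1ℤ) (χ-yes (k <? suc k) ≤-refl) ⟩
  1ℤ ∎
  where
  open ≡-Reasoning
  only-k : ∀ {i} → i ≤ k → χ (k ∸ i ≟ 0) ≡ χ (i ≟ k) * 1ℤ
  only-k {i} i≤k = trans (χ-cong (λ e → ≤-antisym i≤k (m∸n≡0⇒m≤n e)) (λ { refl → n∸n≡0 k }) (k ∸ i ≟ 0) (i ≟ k))
                     (sym (ℤ.*-identityʳ _))

-- Counting trees by pruning

graft-graph : ∀ d T′ cs T → length cs ≡ level d T′ →
              χ (height T′ ≤? d) * χ (T ≟ᵀ graft d T′ cs)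
              ≡ χ (height T ≤? suc d) * (χ (T′ ≟ᵀ prune d T) * χ (cs ≟ˡ childCounts d T))
graft-graph d T′ cs T l = begin
  χ (height T′ ≤? d) * χ (T ≟ᵀ graft d T′ cs)
    ≡⟨ χ-×-dec (height T′ ≤? d) (T ≟ᵀ graft d T′ cs) ⟨
  χ (height T′ ≤? d ×-dec T ≟ᵀ graft d T′ cs)
    ≡⟨ χ-cong grafted pruned (height T′ ≤? d ×-dec T ≟ᵀ graft d T′ cs)
                             (height T ≤? suc d ×-dec (T′ ≟ᵀ prune d T ×-dec cs ≟ˡ childCounts d T)) ⟩
  χ (height T ≤? suc d ×-dec (T′ ≟ᵀ prune d T ×-dec cs ≟ˡ childCounts d T))
    ≡⟨ χ-×-dec (height T ≤? suc d) (T′ ≟ᵀ prune d T ×-dec cs ≟ˡ childCounts d T) ⟩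
  χ (height T ≤? suc d) * χ (T′ ≟ᵀ prune d T ×-dec cs ≟ˡ childCounts d T)
    ≡⟨ cong (χ (height T ≤? suc d) *_) (χ-×-dec (T′ ≟ᵀ prune d T) (cs ≟ˡ childCounts d T)) ⟩
  χ (height T ≤? suc d) * (χ (T′ ≟ᵀ prune d T) * χ (cs ≟ˡ childCounts d T)) ∎
  where
  open ≡-Reasoning
  grafted : height T′ ≤ d × T ≡ graft d T′ cs → height T ≤ suc d × T′ ≡ prune d T × cs ≡ childCounts d T
  grafted (h , refl) = height-graft d T′ cs h , sym (prune-graft d T′ cs h) , sym (childCounts-graft d T′ cs l)
  pruned : height T ≤ suc d × T′ ≡ prune d T × cs ≡ childCounts d T → height T′ ≤ d × T ≡ graft d T′ cs
  pruned (h , refl , refl) = height-prune d T , sym (graft-prune d T h)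

#compositions-as-grafts : ∀ {n k} d T′ → k ≤ n → edges T′ ≡ n ∸ k →
  χ (height T′ ≤? d) * #compositions (level d T′) k
  ≡ ∑[ cs ∈ compositions (level d T′) k ] ∑[ T ∈ trees n ] χ (height T′ ≤? d) * χ (T ≟ᵀ graft d T′ cs)
#compositions-as-grafts {n} {k} d T′ k≤n e = begin
  χ (height T′ ≤? d) * #compositions (level d T′) k
    ≡⟨ ∑-*ˡ (χ (height T′ ≤? d)) (compositions (level d T′) k) _ ⟨
  ∑[ cs ∈ compositions (level d T′) k ] χ (height T′ ≤? d) * 1ℤ
    ≡⟨ ∑-congᴬ (compositions-shape (level d T′) k) (λ (l , s) → graft-counted-once l s) ⟩
  ∑[ cs ∈ compositions (level d T′) k ] χ (height T′ ≤? d) * count _≟ᵀ_ (graft d T′ cs) (trees n)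
    ≡⟨ ∑-cong (compositions (level d T′) k) (λ cs → ∑-*ˡ (χ (height T′ ≤? d)) (trees n) _) ⟨
  ∑[ cs ∈ compositions (level d T′) k ] ∑[ T ∈ trees n ] χ (height T′ ≤? d) * χ (T ≟ᵀ graft d T′ cs) ∎
  where
  open ≡-Reasoning
  graft-counted-once : ∀ {cs} → length cs ≡ level d T′ → sum cs ≡ k →
                       χ (height T′ ≤? d) * 1ℤ ≡ χ (height T′ ≤? d) * count _≟ᵀ_ (graft d T′ cs) (trees n)
  graft-counted-once {cs} l s = χ-*-cong (height T′ ≤? d) λ h →
    sym (trans (count-trees n (graft d T′ cs)) (χ-yes (n ≟ _) (begin
      n                            ≡⟨ m∸n+n≡m k≤n ⟨
      n ∸ k ℕ.+ k                  ≡⟨ cong₂ ℕ._+_ e s ⟨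
      edges T′ ℕ.+ sum cs          ≡⟨ edges-graft d T′ cs h l ⟨
      edges (graft d T′ cs)        ∎)))

∑-graft-preimages : ∀ {n} k d T → edges T ≡ n →
  ∑[ T′ ∈ trees (n ∸ k) ] ∑[ cs ∈ compositions (level d T′) k ] χ (height T′ ≤? d) * χ (T ≟ᵀ graft d T′ cs)
  ≡ χ (height T ≤? suc d) * χ (level (suc d) T ≟ k)
∑-graft-preimages {n} k d T e = begin
  ∑[ T′ ∈ trees (n ∸ k) ] ∑[ cs ∈ compositions (level d T′) k ] χ (height T′ ≤? d) * χ (T ≟ᵀ graft d T′ cs)
    ≡⟨ ∑-cong (trees (n ∸ k)) (λ T′ → ∑-congᴬ (compositions-shape (level d T′) k) (λ (l , _) → graft-graph d T′ _ T l)) ⟩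
  ∑[ T′ ∈ trees (n ∸ k) ] ∑[ cs ∈ compositions (level d T′) k ] χh * (χ (T′ ≟ᵀ prune d T) * χ (cs ≟ˡ cc))
    ≡⟨ ∑-cong (trees (n ∸ k)) (λ T′ → trans (∑-*ˡ χh (compositions (level d T′) k) _)
                                             (cong (χh *_) (∑-*ˡ (χ (T′ ≟ᵀ prune d T)) (compositions (level d T′) k) _))) ⟩
  ∑[ T′ ∈ trees (n ∸ k) ] χh * (χ (T′ ≟ᵀ prune d T) * count _≟ˡ_ cc (compositions (level d T′) k))
    ≡⟨ ∑-*ˡ χh (trees (n ∸ k)) _ ⟩
  χh * (∑[ T′ ∈ trees (n ∸ k) ] χ (T′ ≟ᵀ prune d T) * count _≟ˡ_ cc (compositions (level d T′) k))
    ≡⟨ cong (χh *_) (∑-χ-≟ _≟ᵀ_ (prune d T) (trees (n ∸ k)) _) ⟩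
  χh * (count _≟ˡ_ cc (compositions (level d (prune d T)) k) * count _≟ᵀ_ (prune d T) (trees (n ∸ k)))
    ≡⟨ cong (χh *_) (cong₂ _*_ (count-compositions (level d (prune d T)) k cc) (count-trees (n ∸ k) (prune d T))) ⟩
  χh * ((χ (level d (prune d T) ≟ length cc) * χ (k ≟ sum cc)) * χ (n ∸ k ≟ edges (prune d T)))
    ≡⟨ pruned-counts ⟩
  χh * χ (level (suc d) T ≟ k) ∎
  where
  open ≡-Reasoning
  χh = χ (height T ≤? suc d)
  cc = childCounts d T
  edges-pruned : height T ≤ suc d → edges (prune d T) ≡ n ∸ level (suc d) T
  edges-pruned h = trans (sym (m+n∸n≡m _ (level (suc d) T))) (cong (_∸ level (suc d) T) (trans (edges-prune d T h) e))
  pruned-counts : χh * ((χ (level d (prune d T) ≟ length cc) * χ (k ≟ sum cc)) * χ (n ∸ k ≟ edges (prune d T)))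
                  ≡ χh * χ (level (suc d) T ≟ k)
  pruned-counts = χ-*-cong (height T ≤? suc d) λ h → begin
    (χ (level d (prune d T) ≟ length cc) * χ (k ≟ sum cc)) * χ (n ∸ k ≟ edges (prune d T))
      ≡⟨ cong₂ (λ x y → x * χ (n ∸ k ≟ y))
               (trans (cong (_* χ (k ≟ sum cc)) (χ-yes (level d (prune d T) ≟ length cc) (sym (length-childCounts d T))))
                      (ℤ.*-identityˡ _))
               (edges-pruned h) ⟩
    χ (k ≟ sum cc) * χ (n ∸ k ≟ n ∸ level (suc d) T)
      ≡⟨ cong (λ s → χ (k ≟ s) * χ (n ∸ k ≟ n ∸ level (suc d) T)) (sum-childCounts d T) ⟩
    χ (k ≟ level (suc d) T) * χ (n ∸ k ≟ n ∸ level (suc d) T)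
      ≡⟨ χ-≟-∸ n k (level (suc d) T) ⟩
    χ (level (suc d) T ≟ k) ∎

∑-by-pruning : ∀ n d k → k ≤ n →
  ∑[ T ∈ trees n ] χ (height T ≤? suc d) * χ (level (suc d) T ≟ k)
  ≡ ∑[ T′ ∈ trees (n ∸ k) ] χ (height T′ ≤? d) * #compositions (level d T′) k
∑-by-pruning n d k k≤n = begin
  ∑[ T ∈ trees n ] χ (height T ≤? suc d) * χ (level (suc d) T ≟ k)
    ≡⟨ ∑-congᴬ (edges-trees n) (λ {T} → ∑-graft-preimages k d T) ⟨
  ∑[ T ∈ trees n ] ∑[ T′ ∈ trees (n ∸ k) ] ∑[ cs ∈ compositions (level d T′) k ] grafted T′ cs T
    ≡⟨ ∑-swap (trees n) (trees (n ∸ k)) _ ⟩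
  ∑[ T′ ∈ trees (n ∸ k) ] ∑[ T ∈ trees n ] ∑[ cs ∈ compositions (level d T′) k ] grafted T′ cs T
    ≡⟨ ∑-cong (trees (n ∸ k)) (λ T′ → ∑-swap (trees n) (compositions (level d T′) k) _) ⟩
  ∑[ T′ ∈ trees (n ∸ k) ] ∑[ cs ∈ compositions (level d T′) k ] ∑[ T ∈ trees n ] grafted T′ cs T
    ≡⟨ ∑-congᴬ (edges-trees (n ∸ k)) (λ {T′} → #compositions-as-grafts d T′ k≤n) ⟨
  ∑[ T′ ∈ trees (n ∸ k) ] χ (height T′ ≤? d) * #compositions (level d T′) k ∎
  where
  open ≡-Reasoning
  grafted : Tree → List ℕ → Tree → ℤ
  grafted T′ cs T = χ (height T′ ≤? d) * χ (T ≟ᵀ graft d T′ cs)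

χ-height≤-level : ∀ d T (f : ℕ → ℤ) → f 0 ≡ 0ℤ → χ (height T ≤? d) * f (level d T) ≡ χ (height T ≟ d) * f (mtop T)
χ-height≤-level d T f f0≡0 with <-cmp (height T) d
... | tri< h<d h≢d _
  rewrite χ-yes (height T ≤? d) (<⇒≤ h<d) | χ-no (height T ≟ d) h≢d | level-above-height d T h<d | f0≡0 = refl
... | tri≈ _ refl _ = cong (_* f (mtop T)) (trans (χ-yes (height T ≤? d) ≤-refl) (sym (χ-yes (height T ≟ d) refl)))
... | tri> _ h≢d d<h rewrite χ-no (height T ≤? d) (<⇒≱ d<h) | χ-no (height T ≟ d) h≢d = refl

treeSum : ℕ → ℕ → (ℕ → ℤ) → ℤ
treeSum n h f = ∑[ T ∈ trees n ] χ (height T ≟ h) * f (mtop T)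

treeSum-cong : ∀ n h {f g : ℕ → ℤ} → (∀ m → f m ≡ g m) → treeSum n h f ≡ treeSum n h g
treeSum-cong n h f≗g = ∑-cong (trees n) (λ T → cong (χ (height T ≟ h) *_) (f≗g (mtop T)))

treeSum-zero : ∀ n h → treeSum n h (λ _ → 0ℤ) ≡ 0ℤ
treeSum-zero n h = ∑-zeroᴬ (edges-trees n) (λ {T} _ → ℤ.*-zeroʳ (χ (height T ≟ h)))

treeSum-height-zero : ∀ n f → treeSum (suc n) 0 f ≡ 0ℤ
treeSum-height-zero n f = ∑-zeroᴬ (edges-trees (suc n)) λ {T} e →
  cong (_* f (mtop T)) (χ-no (height T ≟ 0) λ h → 0≢1+n (trans (cong edges (sym (height≤0⇒leaf T (≤-reflexive h)))) e))

treeSum-top-zero : ∀ n h → treeSum n h (λ m → χ (0 ≟ m)) ≡ 0ℤ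
treeSum-top-zero n h = ∑-zeroᴬ (edges-trees n) λ {T} _ →
  trans (cong (χ (height T ≟ h) *_) (χ-no (0 ≟ mtop T) (<⇒≢ (level-height-positive (height T) T refl))))
        (ℤ.*-zeroʳ (χ (height T ≟ h)))

treeSum-top-above-edges : ∀ n d k → n < k → treeSum n (suc d) (λ m → χ (k ≟ m)) ≡ 0ℤ
treeSum-top-above-edges n d k n<k = ∑-zeroᴬ (edges-trees n) λ {T} e →
  trans (χ-*-cong (height T ≟ suc d) λ h → χ-no (k ≟ mtop T) λ k≡m → <⇒≱ n<k (subst (_≤ n) (sym k≡m) (mtop≤n T e h)))
        (ℤ.*-zeroʳ (χ (height T ≟ suc d)))
  where
  mtop≤n : ∀ T → edges T ≡ n → height T ≡ suc d → mtop T ≤ n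
  mtop≤n T e h = subst (λ x → level x T ≤ n) (sym h) (subst (level (suc d) T ≤_) e (level≤edges d T))

treeSum-prune : ∀ n d k → suc k ≤ n →
  treeSum n (suc d) (λ m → χ (suc k ≟ m)) ≡ treeSum (n ∸ suc k) d (λ m → #compositions m (suc k))
treeSum-prune n d k k<n = begin
  ∑[ T ∈ trees n ] χ (height T ≟ suc d) * χ (suc k ≟ mtop T)
    ≡⟨ ∑-cong (trees n) (λ T → trans (cong (χ (height T ≟ suc d) *_) (χ-≟-sym (suc k) (mtop T)))
                                      (sym (χ-height≤-level (suc d) T (λ ℓ → χ (ℓ ≟ suc k)) refl))) ⟩
  ∑[ T ∈ trees n ] χ (height T ≤? suc d) * χ (level (suc d) T ≟ suc k)
    ≡⟨ ∑-by-pruning n d (suc k) k<n ⟩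
  ∑[ T′ ∈ trees (n ∸ suc k) ] χ (height T′ ≤? d) * #compositions (level d T′) (suc k)
    ≡⟨ ∑-cong (trees (n ∸ suc k)) (λ T′ → χ-height≤-level d T′ (λ ℓ → #compositions ℓ (suc k)) refl) ⟩
  ∑[ T′ ∈ trees (n ∸ suc k) ] χ (height T′ ≟ d) * #compositions (mtop T′) (suc k) ∎
  where open ≡-Reasoning

-- Coefficients of the series

monomial : ℕ → ℕ → ℕ → Series
monomial a b c n h k = χ (n ≟ a) * (χ (h ≟ b) * χ (k ≟ c))

*S-monomial : ∀ {s a b c} → s ≈S monomial a b c → ∀ t n h k →
  (s *S t) n h k ≡ χ (a <? suc n) * (χ (b <? suc h) * (χ (c <? suc k) * t (n ∸ a) (h ∸ b) (k ∸ c)))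
*S-monomial {s} {a} {b} {c} s≈ t n h k = begin
  Σ< (suc n) (λ i → Σ< (suc h) (λ j → Σ< (suc k) (λ l → s i j l * t (n ∸ i) (h ∸ j) (k ∸ l))))
    ≡⟨ Σ<-cong (suc n) (λ {i} _ → Σ<-cong (suc h) (λ {j} _ → Σ<-cong (suc k) (λ {l} _ → factor i j l))) ⟩
  Σ< (suc n) (λ i → Σ< (suc h) (λ j → Σ< (suc k) (λ l → χ (i ≟ a) * (χ (j ≟ b) * (χ (l ≟ c) * t (n ∸ i) (h ∸ j) (k ∸ l))))))
    ≡⟨ Σ<-cong (suc n) (λ {i} _ → trans (Σ<-cong (suc h) (λ {j} _ → Σ<-*ˡ (suc k) (χ (i ≟ a)) _)) (Σ<-*ˡ (suc h) (χ (i ≟ a)) _)) ⟩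
  Σ< (suc n) (λ i → χ (i ≟ a) * Σ< (suc h) (λ j → Σ< (suc k) (λ l → χ (j ≟ b) * (χ (l ≟ c) * t (n ∸ i) (h ∸ j) (k ∸ l)))))
    ≡⟨ Σ<-δ (suc n) a _ ⟩
  χ (a <? suc n) * Σ< (suc h) (λ j → Σ< (suc k) (λ l → χ (j ≟ b) * (χ (l ≟ c) * t (n ∸ a) (h ∸ j) (k ∸ l))))
    ≡⟨ cong (χ (a <? suc n) *_) (trans (Σ<-cong (suc h) (λ {j} _ → Σ<-*ˡ (suc k) (χ (j ≟ b)) _)) (Σ<-δ (suc h) b _)) ⟩
  χ (a <? suc n) * (χ (b <? suc h) * Σ< (suc k) (λ l → χ (l ≟ c) * t (n ∸ a) (h ∸ b) (k ∸ l)))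
    ≡⟨ cong (λ x → χ (a <? suc n) * (χ (b <? suc h) * x)) (Σ<-δ (suc k) c _) ⟩
  χ (a <? suc n) * (χ (b <? suc h) * (χ (c <? suc k) * t (n ∸ a) (h ∸ b) (k ∸ c))) ∎
  where
  open ≡-Reasoning
  factor : ∀ i j l → s i j l * t (n ∸ i) (h ∸ j) (k ∸ l)
                     ≡ χ (i ≟ a) * (χ (j ≟ b) * (χ (l ≟ c) * t (n ∸ i) (h ∸ j) (k ∸ l)))
  factor i j l = trans (cong (_* tᵢⱼₗ) (s≈ i j l))
                       (trans (ℤ.*-assoc (χ (i ≟ a)) (χ (j ≟ b) * χ (l ≟ c)) tᵢⱼₗ)
                              (cong (χ (i ≟ a) *_) (ℤ.*-assoc (χ (j ≟ b)) (χ (l ≟ c)) tᵢⱼₗ)))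
    where tᵢⱼₗ = t (n ∸ i) (h ∸ j) (k ∸ l)

*S-monomial-monomial : ∀ {s t a b c a′ b′ c′} → s ≈S monomial a b c → t ≈S monomial a′ b′ c′ →
                       (s *S t) ≈S monomial (a ℕ.+ a′) (b ℕ.+ b′) (c ℕ.+ c′)
*S-monomial-monomial {s} {t} {a} {b} {c} {a′} {b′} {c′} s≈ t≈ n h k = begin
  (s *S t) n h k
    ≡⟨ *S-monomial s≈ t n h k ⟩
  χ (a <? suc n) * (χ (b <? suc h) * (χ (c <? suc k) * t (n ∸ a) (h ∸ b) (k ∸ c)))
    ≡⟨ cong (λ x → χ (a <? suc n) * (χ (b <? suc h) * (χ (c <? suc k) * x))) (t≈ (n ∸ a) (h ∸ b) (k ∸ c)) ⟩
  χ (a <? suc n) * (χ (b <? suc h) * (χ (c <? suc k) * (χ (n ∸ a ≟ a′) * (χ (h ∸ b ≟ b′) * χ (k ∸ c ≟ c′)))))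
    ≡⟨ regroup (χ (a <? suc n)) (χ (b <? suc h)) (χ (c <? suc k)) (χ (n ∸ a ≟ a′)) (χ (h ∸ b ≟ b′)) (χ (k ∸ c ≟ c′)) ⟩
  (χ (a <? suc n) * χ (n ∸ a ≟ a′)) * ((χ (b <? suc h) * χ (h ∸ b ≟ b′)) * (χ (c <? suc k) * χ (k ∸ c ≟ c′)))
    ≡⟨ cong₂ _*_ (χ-∸ n a a′) (cong₂ _*_ (χ-∸ h b b′) (χ-∸ k c c′)) ⟩
  monomial (a ℕ.+ a′) (b ℕ.+ b′) (c ℕ.+ c′) n h k ∎
  where
  open ≡-Reasoning
  open +-*-Solver
  regroup : ∀ x y z u v w → x * (y * (z * (u * (v * w)))) ≡ (x * u) * ((y * v) * (z * w))
  regroup = solve 6 (λ x y z u v w → x :* (y :* (z :* (u :* (v :* w)))) := (x :* u) :* ((y :* v) :* (z :* w))) refl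

oneS≈monomial : oneS ≈S monomial 0 0 0
oneS≈monomial zero    zero    zero    = refl
oneS≈monomial zero    zero    (suc k) = refl
oneS≈monomial zero    (suc h) k       = refl
oneS≈monomial (suc n) h       k       = refl

^S-monomial : ∀ {s a b c} → s ≈S monomial a b c → ∀ m → (s ^S m) ≈S monomial (m ℕ.* a) (m ℕ.* b) (m ℕ.* c)
^S-monomial s≈ zero    = oneS≈monomial
^S-monomial s≈ (suc m) = *S-monomial-monomial s≈ (^S-monomial s≈ m)

X≈monomial : X ≈S monomial 1 0 0
X≈monomial zero                h       k       = refl
X≈monomial (suc zero)          zero    zero    = refl
X≈monomial (suc zero)          zero    (suc k) = refl
X≈monomial (suc zero)          (suc h) k       = refl
X≈monomial (suc (suc n))       h       k       = refl

Y≈monomial : Y ≈S monomial 0 1 0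
Y≈monomial (suc n) h             k       = refl
Y≈monomial zero    zero          k       = refl
Y≈monomial zero    (suc zero)    zero    = refl
Y≈monomial zero    (suc zero)    (suc k) = refl
Y≈monomial zero    (suc (suc h)) k       = refl

Z≈monomial : Z ≈S monomial 0 0 1
Z≈monomial (suc n) h       k             = refl
Z≈monomial zero    (suc h) k             = refl
Z≈monomial zero    zero    zero          = refl
Z≈monomial zero    zero    (suc zero)    = refl
Z≈monomial zero    zero    (suc (suc k)) = refl

-- diagonal σ is the series Σₖ σ k (xz)ᵏ.
diagonal : (ℕ → ℤ) → Series
diagonal σ n h k = χ (n ≟ k) * (χ (h ≟ 0) * σ k)

*S-diagonal : ∀ {s t σ τ} → s ≈S diagonal σ → t ≈S diagonal τ →
              (s *S t) ≈S diagonal (λ k → Σ< (suc k) (λ i → σ i * τ (k ∸ i)))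
*S-diagonal {s} {t} {σ} {τ} s≈ t≈ n h k = begin
  Σ< (suc n) (λ i → Σ< (suc h) (λ j → Σ< (suc k) (λ l → s i j l * t (n ∸ i) (h ∸ j) (k ∸ l))))
    ≡⟨ Σ<-cong (suc n) (λ {i} _ → Σ<-cong (suc h) (λ {j} _ →
         trans (Σ<-cong (suc k) (λ {l} _ → factor i j l)) (Σ<-*ˡ (suc k) (χ (j ≟ 0)) _))) ⟩
  Σ< (suc n) (λ i → Σ< (suc h) (λ j → χ (j ≟ 0) * Σ< (suc k) (λ l → χ (l ≟ i) * term i j l)))
    ≡⟨ Σ<-cong (suc n) (λ {i} _ → Σ<-δ (suc h) 0 _) ⟩
  Σ< (suc n) (λ i → 1ℤ * Σ< (suc k) (λ l → χ (l ≟ i) * term i 0 l))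
    ≡⟨ Σ<-cong (suc n) (λ {i} i<1+n → trans (ℤ.*-identityˡ _) (trans (Σ<-δ (suc k) i (term i 0)) (pick-diagonal i (≤-pred i<1+n)))) ⟩
  Σ< (suc n) (λ i → χ (n ≟ k) * (χ (h ≟ 0) * (σ i * τ (k ∸ i))))
    ≡⟨ trans (Σ<-*ˡ (suc n) (χ (n ≟ k)) _) (cong (χ (n ≟ k) *_) (Σ<-*ˡ (suc n) (χ (h ≟ 0)) _)) ⟩
  χ (n ≟ k) * (χ (h ≟ 0) * Σ< (suc n) (λ i → σ i * τ (k ∸ i)))
    ≡⟨ χ-*-cong (n ≟ k) (λ { refl → refl }) ⟩
  χ (n ≟ k) * (χ (h ≟ 0) * Σ< (suc k) (λ i → σ i * τ (k ∸ i))) ∎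
  where
  open ≡-Reasoning
  open +-*-Solver
  term : ℕ → ℕ → ℕ → ℤ
  term i j l = χ (n ∸ i ≟ k ∸ l) * (χ (h ∸ j ≟ 0) * (σ l * τ (k ∸ l)))
  pick-diagonal : ∀ i → i ≤ n → χ (i <? suc k) * term i 0 i ≡ χ (n ≟ k) * (χ (h ≟ 0) * (σ i * τ (k ∸ i)))
  pick-diagonal i i≤n = trans (sym (ℤ.*-assoc (χ (i <? suc k)) (χ (n ∸ i ≟ k ∸ i)) (χ (h ≟ 0) * (σ i * τ (k ∸ i)))))
                              (cong (_* (χ (h ≟ 0) * (σ i * τ (k ∸ i)))) (χ-<-∸-≟ k i≤n))
  factor : ∀ i j l → s i j l * t (n ∸ i) (h ∸ j) (k ∸ l) ≡ χ (j ≟ 0) * (χ (l ≟ i) * term i j l)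
  factor i j l = begin
    s i j l * t (n ∸ i) (h ∸ j) (k ∸ l)
      ≡⟨ cong₂ _*_ (s≈ i j l) (t≈ (n ∸ i) (h ∸ j) (k ∸ l)) ⟩
    (χ (i ≟ l) * (χ (j ≟ 0) * σ l)) * (χ (n ∸ i ≟ k ∸ l) * (χ (h ∸ j ≟ 0) * τ (k ∸ l)))
      ≡⟨ regroup (χ (i ≟ l)) (χ (j ≟ 0)) (σ l) (χ (n ∸ i ≟ k ∸ l)) (χ (h ∸ j ≟ 0)) (τ (k ∸ l)) ⟩
    χ (j ≟ 0) * (χ (i ≟ l) * term i j l)
      ≡⟨ cong (λ x → χ (j ≟ 0) * (x * term i j l)) (χ-≟-sym i l) ⟩
    χ (j ≟ 0) * (χ (l ≟ i) * term i j l) ∎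
    where
    regroup : ∀ a b x c d y → (a * (b * x)) * (c * (d * y)) ≡ b * (a * (c * (d * (x * y))))
    regroup = solve 6 (λ a b x c d y → (a :* (b :* x)) :* (c :* (d :* y)) := b :* (a :* (c :* (d :* (x :* y))))) refl

geomXZ≈diagonal : geomXZ ≈S diagonal (λ _ → 1ℤ)
geomXZ≈diagonal n zero    k = sym (ℤ.*-identityʳ (χ (n ≟ k)))
geomXZ≈diagonal n (suc h) k = sym (ℤ.*-zeroʳ (χ (n ≟ k)))

oneS≈diagonal : oneS ≈S diagonal (#compositions 0)
oneS≈diagonal zero    zero    zero    = refl
oneS≈diagonal zero    zero    (suc k) = refl
oneS≈diagonal (suc n) zero    zero    = refl
oneS≈diagonal (suc n) zero    (suc k) = sym (ℤ.*-zeroʳ (χ (n ≟ k)))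
oneS≈diagonal zero    (suc h) k       = sym (ℤ.*-zeroʳ (χ (0 ≟ k)))
oneS≈diagonal (suc n) (suc h) k       = sym (ℤ.*-zeroʳ (χ (suc n ≟ k)))

^S-geomXZ : ∀ m → (geomXZ ^S m) ≈S diagonal (#compositions m)
^S-geomXZ zero            = oneS≈diagonal
^S-geomXZ (suc m) n h k = trans (*S-diagonal geomXZ≈diagonal (^S-geomXZ m) n h k)
  (cong (λ x → χ (n ≟ k) * (χ (h ≟ 0) * x))
        (trans (Σ<-cong (suc k) (λ _ → ℤ.*-identityˡ _)) (sym (#compositions-suc m k))))

shiftXY-≤ : ∀ {a n} b s h k → a ≤ n → shiftXY a b s n h k ≡ χ (b ≤? h) * s (n ∸ a) (h ∸ b) k
shiftXY-≤ {a} {n} b s h k a≤n rewrite dec-true (a ≤? n) a≤n with b ≤ᵇ h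
... | true  = sym (ℤ.*-identityˡ _)
... | false = refl

Dsub-coefficient : ∀ g (ρ : ℕ → ℕ) (ψ : ℕ → ℕ → ℤ) →
  (∀ m → (g ^S m) ≈S (λ a b c → χ (a ≟ ρ c) * (χ (b ≟ 0) * ψ m c))) →
  ∀ n h k → Dsub g n h k ≡ χ (ρ k <? n) * treeSum (n ∸ ρ k) h (λ m → ψ m k)
Dsub-coefficient g ρ ψ g^≈ n h k = begin
  Dsub g n h k
    ≡⟨ Σ<-cong n (λ {i} i<n → ∑-congᴬ (edges-trees (suc i)) (λ {T} e → shifted-term i<n T e)) ⟩
  Σ< n (λ i → ∑[ T ∈ trees (suc i) ] χ (n ∸ suc i ≟ ρ k) * (χ (height T ≟ h) * ψ (mtop T) k))
    ≡⟨ Σ<-cong n (λ {i} _ → ∑-*ˡ (χ (n ∸ suc i ≟ ρ k)) (trees (suc i)) _) ⟩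
  Σ< n (λ i → χ (n ∸ suc i ≟ ρ k) * treeSum (suc i) h (λ m → ψ m k))
    ≡⟨ Σ<-δ-from-top n (ρ k) (λ j → treeSum j h (λ m → ψ m k)) ⟩
  χ (ρ k <? n) * treeSum (n ∸ ρ k) h (λ m → ψ m k) ∎
  where
  open ≡-Reasoning
  shifted-term : ∀ {i} → i < n → ∀ T → edges T ≡ suc i →
    shiftXY (edges T) (height T) (g ^S mtop T) n h k ≡ χ (n ∸ suc i ≟ ρ k) * (χ (height T ≟ h) * ψ (mtop T) k)
  shifted-term {i} i<n T e rewrite e = begin
    shiftXY (suc i) (height T) (g ^S mtop T) n h k
      ≡⟨ shiftXY-≤ (height T) (g ^S mtop T) h k i<n ⟩
    χ (height T ≤? h) * (g ^S mtop T) (n ∸ suc i) (h ∸ height T) k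
      ≡⟨ cong (χ (height T ≤? h) *_) (g^≈ (mtop T) (n ∸ suc i) (h ∸ height T) k) ⟩
    χ (height T ≤? h) * (χ (n ∸ suc i ≟ ρ k) * (χ (h ∸ height T ≟ 0) * ψ (mtop T) k))
      ≡⟨ x∙yz≈y∙xz (χ (height T ≤? h)) (χ (n ∸ suc i ≟ ρ k)) _ ⟩
    χ (n ∸ suc i ≟ ρ k) * (χ (height T ≤? h) * (χ (h ∸ height T ≟ 0) * ψ (mtop T) k))
      ≡⟨ cong (χ (n ∸ suc i ≟ ρ k) *_) (ℤ.*-assoc (χ (height T ≤? h)) (χ (h ∸ height T ≟ 0)) (ψ (mtop T) k)) ⟨
    χ (n ∸ suc i ≟ ρ k) * ((χ (height T ≤? h) * χ (h ∸ height T ≟ 0)) * ψ (mtop T) k)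
      ≡⟨ cong (λ x → χ (n ∸ suc i ≟ ρ k) * (x * ψ (mtop T) k)) (χ-≤-∸ (height T) h) ⟩
    χ (n ∸ suc i ≟ ρ k) * (χ (height T ≟ h) * ψ (mtop T) k) ∎

D-coefficient : ∀ n h k → D n h k ≡ χ (0 <? n) * treeSum n h (λ m → χ (k ≟ m))
D-coefficient = Dsub-coefficient Z (λ _ → 0) (λ m c → χ (c ≟ m)) Z^S≈
  where
  Z^S≈ : ∀ m → (Z ^S m) ≈S monomial 0 0 m
  Z^S≈ m a b c = trans (^S-monomial Z≈monomial m a b c) (cong₂ (λ z o → monomial z z o a b c) (*-zeroʳ m) (*-identityʳ m))

Dsub-oneS-coefficient : ∀ n h k → Dsub oneS n h k ≡ χ (0 <? n) * treeSum n h (λ _ → χ (k ≟ 0))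
Dsub-oneS-coefficient = Dsub-coefficient oneS (λ _ → 0) (λ _ c → χ (c ≟ 0)) oneS^S≈
  where
  oneS^S≈ : ∀ m → (oneS ^S m) ≈S monomial 0 0 0
  oneS^S≈ m a b c = trans (^S-monomial oneS≈monomial m a b c) (cong (λ z → monomial z z z a b c) (*-zeroʳ m))

Dsub-geomXZ-coefficient : ∀ n h k → Dsub geomXZ n h k ≡ χ (k <? n) * treeSum (n ∸ k) h (λ m → #compositions m k)
Dsub-geomXZ-coefficient = Dsub-coefficient geomXZ (λ c → c) #compositions ^S-geomXZ

*S-Y-zero : ∀ s n k → (Y *S s) n 0 k ≡ 0ℤ
*S-Y-zero s n k = *S-monomial Y≈monomial s n 0 k

*S-Y-suc : ∀ s n h k → (Y *S s) n (suc h) k ≡ s n h k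
*S-Y-suc s n h k = trans (*S-monomial Y≈monomial s n (suc h) k)
                         (trans (ℤ.*-identityˡ _) (trans (ℤ.*-identityˡ _) (ℤ.*-identityˡ _)))

XYZ-geomXZ-coefficient : ∀ n h k →
  (X *S Y *S Z *S geomXZ) n h k ≡ χ (1 <? suc n) * (χ (1 <? suc h) * (χ (1 <? suc k) * geomXZ (n ∸ 1) (h ∸ 1) (k ∸ 1)))
XYZ-geomXZ-coefficient = *S-monomial (*S-monomial-monomial (*S-monomial-monomial X≈monomial Y≈monomial) Z≈monomial) geomXZ

geomXZ-off-diagonal : ∀ n h k → n ≢ k → geomXZ n h k ≡ 0ℤ
geomXZ-off-diagonal n zero    k n≢k = χ-no (n ≟ k) n≢k
geomXZ-off-diagonal n (suc h) k _   = refl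

geomXZ-diagonal : ∀ n h → geomXZ n h n ≡ χ (0 ≟ h)
geomXZ-diagonal n zero    = χ-yes (n ≟ n) refl
geomXZ-diagonal n (suc h) = refl

-- The geomXZ term counts the stars (k = n), whose pruned tree is the single vertex omitted by Dsub.
treeSum-suc-top : ∀ n d k →
  treeSum (suc n) (suc d) (λ m → χ (suc k ≟ m))
  ≡ χ (suc k <? suc n) * treeSum (n ∸ k) d (λ m → #compositions m (suc k)) + geomXZ n d k
treeSum-suc-top n d k with <-cmp k n
... | tri< k<n k≢n _ = begin
  treeSum (suc n) (suc d) (λ m → χ (suc k ≟ m))
    ≡⟨ treeSum-prune (suc n) d k (s≤s (<⇒≤ k<n)) ⟩
  treeSum (n ∸ k) d (λ m → #compositions m (suc k))
    ≡⟨ trans (ℤ.+-identityʳ _) (ℤ.*-identityˡ _) ⟨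
  1ℤ * treeSum (n ∸ k) d (λ m → #compositions m (suc k)) + 0ℤ
    ≡⟨ cong₂ (λ x y → x * treeSum (n ∸ k) d (λ m → #compositions m (suc k)) + y)
             (χ-yes (suc k <? suc n) (s≤s k<n)) (geomXZ-off-diagonal n d k (k≢n ∘ sym)) ⟨
  χ (suc k <? suc n) * treeSum (n ∸ k) d (λ m → #compositions m (suc k)) + geomXZ n d k ∎
  where open ≡-Reasoning
... | tri≈ _ refl _ = begin
  treeSum (suc k) (suc d) (λ m → χ (suc k ≟ m))
    ≡⟨ treeSum-prune (suc k) d k ≤-refl ⟩
  treeSum (k ∸ k) d (λ m → #compositions m (suc k))
    ≡⟨ cong (λ j → treeSum j d (λ m → #compositions m (suc k))) (n∸n≡0 k) ⟩
  χ (0 ≟ d) * #compositions 1 (suc k) + 0ℤ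
    ≡⟨ trans (ℤ.+-identityʳ _) (trans (cong (χ (0 ≟ d) *_) (#compositions-one-part (suc k))) (ℤ.*-identityʳ _)) ⟩
  χ (0 ≟ d)
    ≡⟨ trans (ℤ.+-identityˡ _) (geomXZ-diagonal k d) ⟨
  0ℤ + geomXZ k d k
    ≡⟨ cong (λ x → x * treeSum (k ∸ k) d (λ m → #compositions m (suc k)) + geomXZ k d k) (χ-no (suc k <? suc k) (<-irrefl refl)) ⟨
  χ (suc k <? suc k) * treeSum (k ∸ k) d (λ m → #compositions m (suc k)) + geomXZ k d k ∎
  where open ≡-Reasoning
... | tri> _ k≢n n<k = begin
  treeSum (suc n) (suc d) (λ m → χ (suc k ≟ m))
    ≡⟨ treeSum-top-above-edges (suc n) d (suc k) (s≤s n<k) ⟩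
  0ℤ
    ≡⟨ cong₂ (λ x y → x * treeSum (n ∸ k) d (λ m → #compositions m (suc k)) + y)
             (χ-no (suc k <? suc n) (<-asym n<k ∘ ≤-pred)) (geomXZ-off-diagonal n d k (k≢n ∘ sym)) ⟨
  χ (suc k <? suc n) * treeSum (n ∸ k) d (λ m → #compositions m (suc k)) + geomXZ n d k ∎
  where open ≡-Reasoning

coefficient-height-zero : ∀ n k → χ (0 <? n) * treeSum n 0 (λ m → χ (k ≟ m)) ≡ 0ℤ
coefficient-height-zero zero    k = refl
coefficient-height-zero (suc n) k = cong (1ℤ *_) (treeSum-height-zero n (λ m → χ (k ≟ m)))

coefficient-identity : ∀ n d k →
  χ (0 <? n) * treeSum n (suc d) (λ m → χ (k ≟ m))
  ≡ χ (k <? n) * treeSum (n ∸ k) d (λ m → #compositions m k) - χ (0 <? n) * treeSum n d (λ _ → χ (k ≟ 0))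
    + χ (1 <? suc n) * (χ (1 <? suc k) * geomXZ (n ∸ 1) d (k ∸ 1))
coefficient-identity zero    d k       = refl
coefficient-identity (suc n) d zero    = begin
  1ℤ * treeSum (suc n) (suc d) (λ m → χ (0 ≟ m))
    ≡⟨ cong (1ℤ *_) (treeSum-top-zero (suc n) (suc d)) ⟩
  0ℤ
    ≡⟨ ℤ.+-inverseʳ (1ℤ * treeSum (suc n) d (λ _ → 1ℤ)) ⟨
  1ℤ * treeSum (suc n) d (λ _ → 1ℤ) - 1ℤ * treeSum (suc n) d (λ _ → 1ℤ)
    ≡⟨ cong (λ x → 1ℤ * x - 1ℤ * treeSum (suc n) d (λ _ → 1ℤ)) (treeSum-cong (suc n) d #compositions-of-zero) ⟨
  1ℤ * treeSum (suc n) d (λ m → #compositions m 0) - 1ℤ * treeSum (suc n) d (λ _ → 1ℤ)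
    ≡⟨ ℤ.+-identityʳ _ ⟨
  1ℤ * treeSum (suc n) d (λ m → #compositions m 0) - 1ℤ * treeSum (suc n) d (λ _ → 1ℤ) + 0ℤ ∎
  where open ≡-Reasoning
coefficient-identity (suc n) d (suc k) = begin
  1ℤ * treeSum (suc n) (suc d) (λ m → χ (suc k ≟ m))
    ≡⟨ trans (ℤ.*-identityˡ _) (treeSum-suc-top n d k) ⟩
  χ (suc k <? suc n) * treeSum (n ∸ k) d (λ m → #compositions m (suc k)) + geomXZ n d k
    ≡⟨ cong₂ _+_ (trans (cong (λ x → pruned-sum - 1ℤ * x) (treeSum-zero (suc n) d)) (ℤ.+-identityʳ pruned-sum))
                 (trans (ℤ.*-identityˡ (1ℤ * geomXZ n d k)) (ℤ.*-identityˡ (geomXZ n d k))) ⟨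
  χ (suc k <? suc n) * treeSum (n ∸ k) d (λ m → #compositions m (suc k)) - 1ℤ * treeSum (suc n) d (λ _ → 0ℤ)
    + 1ℤ * (1ℤ * geomXZ n d k) ∎
  where
  open ≡-Reasoning
  pruned-sum = χ (suc k <? suc n) * treeSum (n ∸ k) d (λ m → #compositions m (suc k))

mainTheorem10 : D ≈S ((Y *S Dsub geomXZ) -S (Y *S Dsub oneS) +S (X *S Y *S Z *S geomXZ))
mainTheorem10 n zero    k = begin
  D n 0 k
    ≡⟨ D-coefficient n 0 k ⟩
  χ (0 <? n) * treeSum n 0 (λ m → χ (k ≟ m))
    ≡⟨ coefficient-height-zero n k ⟩
  0ℤ
    ≡⟨ cong₂ _+_ (cong₂ _-_ (*S-Y-zero (Dsub geomXZ) n k) (*S-Y-zero (Dsub oneS) n k))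
                 (trans (XYZ-geomXZ-coefficient n 0 k) (ℤ.*-zeroʳ (χ (1 <? suc n)))) ⟨
  (Y *S Dsub geomXZ) n 0 k - (Y *S Dsub oneS) n 0 k + (X *S Y *S Z *S geomXZ) n 0 k ∎
  where open ≡-Reasoning
mainTheorem10 n (suc d) k = begin
  D n (suc d) k
    ≡⟨ D-coefficient n (suc d) k ⟩
  χ (0 <? n) * treeSum n (suc d) (λ m → χ (k ≟ m))
    ≡⟨ coefficient-identity n d k ⟩
  χ (k <? n) * treeSum (n ∸ k) d (λ m → #compositions m k) - χ (0 <? n) * treeSum n d (λ _ → χ (k ≟ 0))
    + χ (1 <? suc n) * (χ (1 <? suc k) * geomXZ (n ∸ 1) d (k ∸ 1))
    ≡⟨ cong₂ _+_ (cong₂ _-_ (trans (*S-Y-suc (Dsub geomXZ) n d k) (Dsub-geomXZ-coefficient n d k))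
                            (trans (*S-Y-suc (Dsub oneS) n d k) (Dsub-oneS-coefficient n d k)))
                 (trans (XYZ-geomXZ-coefficient n (suc d) k) (cong (χ (1 <? suc n) *_) (ℤ.*-identityˡ _))) ⟨
  (Y *S Dsub geomXZ) n (suc d) k - (Y *S Dsub oneS) n (suc d) k + (X *S Y *S Z *S geomXZ) n (suc d) k ∎
  where open ≡-Reasoning
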